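{- Let $\mathbb{A}$ be a perfect Heyting algebra, $\mathfrak{F}=(W,R)$ an $\mathbb{A}$-frame, $w\in W$, $a\in A$, and $\phi,\psi$ $L_{\mathbb{A}}$-formulas that do not share propositional variables. Then $\mathfrak{F},w\Vdash_a\phi\vee\psi$ if and only if there are $a_1,a_2\in A$ such that $\mathfrak{F},w\Vdash_{a_1}\phi$, $\mathfrak{F},w\Vdash_{a_2}\psi$ and $a_1\vee a_2\ge a$.
   Context: $\mathbb{A}=(A,\vee,\wedge,\rightarrow,0,1)$ is a Heyting algebra whose lattice is complete, with completely join-irreducible elements join-dense and completely meet-irreducible elements meet-dense. An $\mathbb{A}$-frame is $(W,R)$ with $W\ne\emptyset$, $R:W\times W\to A$. $L_{\mathbb{A}}$-formulas: $\phi::=\mathbf{a}\mid p\mid\phi\vee\phi\mid\phi\wedge\phi\mid\phi\rightarrow\phi\mid\Box\phi\mid\Diamond\phi$ with a constant $\mathbf{a}$ for each $a\in A$. A valuation $V$ gives each propositional variable a value in $A$ at each state and is extended by $V(\mathbf{a},w)=a$, $\vee,\wedge,\rightarrow$ pointwise in $\mathbb{A}$, $V(\Diamond\phi,w)=\bigvee_u(R(w,u)\wedge V(\phi,u))$, $V(\Box\phi,w)=\bigwedge_u(R(w,u)\rightarrow V(\phi,u))$. $\mathfrak{F},w\Vdash_a\phi$ means $V(\phi,w)\ge a$ for every valuation $V$ on $\mathfrak{F}$. -}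

module Defs where

open import Level using (0ℓ)
open import Data.Nat using (ℕ)
open import Data.Product using (Σ; ∃; _×_; _,_; proj₁)
open import Relation.Nullary using (¬_)
open import Relation.Binary.PropositionalEquality using (_≡_)

record CompleteHeytingAlgebra : Set₁ where
  infixr 6 _∨_
  infixr 7 _∧_
  infixr 5 _⇒_
  infix 4 _≤_
  field
    Carrier : Set
    _≤_     : Carrier → Carrier → Set
    ≤-refl    : ∀ {x} → x ≤ x
    ≤-trans   : ∀ {x y z} → x ≤ y → y ≤ z → x ≤ z
    ≤-antisym : ∀ {x y} → x ≤ y → y ≤ x → x ≡ y
    _∨_ _∧_ _⇒_ : Carrier → Carrier → Carrier
    𝟘 𝟙 : Carrier
    ∨-upperˡ : ∀ x y → x ≤ x ∨ y
    ∨-upperʳ : ∀ x y → y ≤ x ∨ y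
    ∨-least  : ∀ {x y z} → x ≤ z → y ≤ z → x ∨ y ≤ z
    ∧-lowerˡ : ∀ x y → x ∧ y ≤ x
    ∧-lowerʳ : ∀ x y → x ∧ y ≤ y
    ∧-greatest : ∀ {x y z} → z ≤ x → z ≤ y → z ≤ x ∧ y
    𝟘-least  : ∀ x → 𝟘 ≤ x
    𝟙-greatest : ∀ x → x ≤ 𝟙
    ⇒-residual₁ : ∀ {x y z} → x ∧ y ≤ z → x ≤ y ⇒ z
    ⇒-residual₂ : ∀ {x y z} → x ≤ y ⇒ z → x ∧ y ≤ z
    ⋁ : {I : Set} → (I → Carrier) → Carrier
    ⋀ : {I : Set} → (I → Carrier) → Carrier
    ⋁-upper : ∀ {I} (f : I → Carrier) (i : I) → f i ≤ ⋁ f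
    ⋁-least : ∀ {I} (f : I → Carrier) {z} → (∀ i → f i ≤ z) → ⋁ f ≤ z
    ⋀-lower : ∀ {I} (f : I → Carrier) (i : I) → ⋀ f ≤ f i
    ⋀-greatest : ∀ {I} (f : I → Carrier) {z} → (∀ i → z ≤ f i) → z ≤ ⋀ f

  -- j is completely join-irreducible: whenever j is the join of a family,
  -- j is one of its members (in particular j ≠ 𝟘 = ⋁ of the empty family).
  CompletelyJoinIrreducible : Carrier → Set₁
  CompletelyJoinIrreducible j =
    ∀ {I : Set} (f : I → Carrier) → j ≡ ⋁ f → ∃ λ i → j ≡ f i

  CompletelyMeetIrreducible : Carrier → Set₁
  CompletelyMeetIrreducible m =
    ∀ {I : Set} (f : I → Carrier) → m ≡ ⋀ f → ∃ λ i → m ≡ f i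

-- Since CompletelyJoinIrreducible lives in Set₁, the density conditions
-- are expressed by supplying the predicate J∞ (resp. M∞) as a Set-valued
-- predicate that is exactly the completely join- (meet-) irreducibles.
record PerfectHeytingAlgebra : Set₂ where
  field
    cha : CompleteHeytingAlgebra
  open CompleteHeytingAlgebra cha public
  field
    J∞ : Carrier → Set
    J∞-sound    : ∀ j → J∞ j → CompletelyJoinIrreducible j
    J∞-complete : ∀ j → CompletelyJoinIrreducible j → J∞ j
    M∞ : Carrier → Set
    M∞-sound    : ∀ m → M∞ m → CompletelyMeetIrreducible m
    M∞-complete : ∀ m → CompletelyMeetIrreducible m → M∞ m
    join-dense : ∀ a → a ≡ ⋁ {Σ Carrier (λ j → J∞ j × j ≤ a)} proj₁
    meet-dense : ∀ a → a ≡ ⋀ {Σ Carrier (λ m → M∞ m × a ≤ m)} proj₁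

module _ (𝔸 : PerfectHeytingAlgebra) where
  open PerfectHeytingAlgebra 𝔸

  data Formula : Set where
    const : Carrier → Formula
    var   : ℕ → Formula
    _∨f_ _∧f_ _⇒f_ : Formula → Formula → Formula
    □ ◇ : Formula → Formula

  record Frame : Set₁ where
    field
      W : Set
      inhabited : W
      R : W → W → Carrier

  Valuation : Set → Set
  Valuation W = ℕ → W → Carrier

  eval : (F : Frame) → Valuation (Frame.W F) → Formula → Frame.W F → Carrier
  eval F V (const a) w = a
  eval F V (var p) w = V p w
  eval F V (φ ∨f ψ) w = eval F V φ w ∨ eval F V ψ w
  eval F V (φ ∧f ψ) w = eval F V φ w ∧ eval F V ψ w
  eval F V (φ ⇒f ψ) w = eval F V φ w ⇒ eval F V ψ w
  eval F V (◇ φ) w = ⋁ (λ u → Frame.R F w u ∧ eval F V φ u)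
  eval F V (□ φ) w = ⋀ (λ u → Frame.R F w u ⇒ eval F V φ u)

  Forces : (F : Frame) → Frame.W F → Carrier → Formula → Set
  Forces F w a φ = ∀ (V : Valuation (Frame.W F)) → a ≤ eval F V φ w

  data Occurs (p : ℕ) : Formula → Set where
    here : Occurs p (var p)
    ∨ˡ : ∀ {φ ψ} → Occurs p φ → Occurs p (φ ∨f ψ)
    ∨ʳ : ∀ {φ ψ} → Occurs p ψ → Occurs p (φ ∨f ψ)
    ∧ˡ : ∀ {φ ψ} → Occurs p φ → Occurs p (φ ∧f ψ)
    ∧ʳ : ∀ {φ ψ} → Occurs p ψ → Occurs p (φ ∧f ψ)
    ⇒ˡ : ∀ {φ ψ} → Occurs p φ → Occurs p (φ ⇒f ψ)
    ⇒ʳ : ∀ {φ ψ} → Occurs p ψ → Occurs p (φ ⇒f ψ)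
    in□ : ∀ {φ} → Occurs p φ → Occurs p (□ φ)
    in◇ : ∀ {φ} → Occurs p φ → Occurs p (◇ φ)

  NoSharedVars : Formula → Formula → Set
  NoSharedVars φ ψ = ∀ p → Occurs p φ → ¬ Occurs p ψ

{-# OPTIONS --safe #-}
module Submission where

-- Take a₁ and a₂ to be the largest degrees to which φ and ψ are valid at w,
-- i.e. the meets of their values over all valuations. Since φ and ψ share no
-- variables, any two valuations can be spliced into one, so forcing φ ∨ ψ to
-- degree a gives a ≤ ⟦φ⟧V₁ ∨ ⟦ψ⟧V₂ for all V₁, V₂. It remains to pull the
-- meets through the join, ⋀ᵢ ⋀ₖ (fᵢ ∨ gₖ) ≤ ⋀ f ∨ ⋀ g, which holds in a
-- perfect Heyting algebra: completely join-irreducibles are join-prime and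
-- join-dense, and meet-density makes ≤ stable under double negation, which
-- replaces the classical case distinctions.

open import Defs
open import Data.Bool using (Bool; true; false)
open import Data.Empty using (⊥-elim)
open import Data.Nat.Properties using (_≟_)
open import Data.Product using (∃-syntax; _×_; _,_; proj₁)
open import Data.Sum using (_⊎_; inj₁; inj₂; [_,_]′; fromInj₁)
open import Function using (_∘_)
open import Relation.Nullary using (¬_; Dec; yes; no)
open import Relation.Nullary.Decidable using (map′; _⊎-dec_)
open import Relation.Binary.PropositionalEquality using (_≡_; refl; sym; subst)

module CompleteHeytingAlgebraProperties (H : CompleteHeytingAlgebra) where
  open CompleteHeytingAlgebra H

  ≡⇒≤ : ∀ {x y} → x ≡ y → x ≤ y
  ≡⇒≤ refl = ≤-refl

  ∧-comm-≤ : ∀ x y → x ∧ y ≤ y ∧ x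
  ∧-comm-≤ x y = ∧-greatest (∧-lowerʳ x y) (∧-lowerˡ x y)

  ∨-mono-≤ : ∀ {x y x′ y′} → x ≤ x′ → y ≤ y′ → x ∨ y ≤ x′ ∨ y′
  ∨-mono-≤ p q = ∨-least (≤-trans p (∨-upperˡ _ _)) (≤-trans q (∨-upperʳ _ _))

  ∧-mono-≤ : ∀ {x y x′ y′} → x ≤ x′ → y ≤ y′ → x ∧ y ≤ x′ ∧ y′
  ∧-mono-≤ p q = ∧-greatest (≤-trans (∧-lowerˡ _ _) p) (≤-trans (∧-lowerʳ _ _) q)

  modus-ponens : ∀ x y → (x ⇒ y) ∧ x ≤ y
  modus-ponens x y = ⇒-residual₂ ≤-refl

  ⇒-mono-≤ : ∀ {x y x′ y′} → x′ ≤ x → y ≤ y′ → x ⇒ y ≤ x′ ⇒ y′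
  ⇒-mono-≤ {x} {y} p q =
    ⇒-residual₁ (≤-trans (∧-mono-≤ ≤-refl p) (≤-trans (modus-ponens x y) q))

  ⋁-mono-≤ : ∀ {I} (f g : I → Carrier) → (∀ i → f i ≤ g i) → ⋁ f ≤ ⋁ g
  ⋁-mono-≤ f g f≤g = ⋁-least f (λ i → ≤-trans (f≤g i) (⋁-upper g i))

  ⋀-mono-≤ : ∀ {I} (f g : I → Carrier) → (∀ i → f i ≤ g i) → ⋀ f ≤ ⋀ g
  ⋀-mono-≤ f g f≤g = ⋀-greatest g (λ i → ≤-trans (⋀-lower f i) (f≤g i))

  ∧-distribˡ-∨-≤ : ∀ x y z → x ∧ (y ∨ z) ≤ (x ∧ y) ∨ (x ∧ z)
  ∧-distribˡ-∨-≤ x y z = ≤-trans (∧-comm-≤ x (y ∨ z)) (⇒-residual₂ (∨-least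
    (⇒-residual₁ (≤-trans (∧-comm-≤ y x) (∨-upperˡ _ _)))
    (⇒-residual₁ (≤-trans (∧-comm-≤ z x) (∨-upperʳ _ _)))))

  module _ {m : Carrier} (irr : CompletelyMeetIrreducible m) where

    completelyMeetIrreducible⇒𝟙≰ : ¬ (𝟙 ≤ m)
    completelyMeetIrreducible⇒𝟙≰ 𝟙≤m with irr ⊥-elim m≡⋀∅
      where
        m≡⋀∅ : m ≡ ⋀ ⊥-elim
        m≡⋀∅ = ≤-antisym (⋀-greatest ⊥-elim (λ ())) (≤-trans (𝟙-greatest _) 𝟙≤m)
    ... | () , _

    meetIrreducible-binary : ∀ {x y} → m ≤ x → m ≤ y → x ∧ y ≤ m → m ≡ x ⊎ m ≡ y
    meetIrreducible-binary {x} {y} m≤x m≤y x∧y≤m with irr pair m≡⋀pair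
      where
        pair : Bool → Carrier
        pair true  = x
        pair false = y
        m≡⋀pair : m ≡ ⋀ pair
        m≡⋀pair = ≤-antisym
          (⋀-greatest pair λ { true → m≤x ; false → m≤y })
          (≤-trans (∧-greatest (⋀-lower pair true) (⋀-lower pair false)) x∧y≤m)
    ... | true  , m≡x = inj₁ m≡x
    ... | false , m≡y = inj₂ m≡y

    -- m = (x ⇒ m) ∧ (x ∨ m), and irreducibility picks the factor that decides x ≤ m.
    completelyMeetIrreducible-≤? : ∀ x → Dec (x ≤ m)
    completelyMeetIrreducible-≤? x with meetIrreducible-binary {x ⇒ m} {x ∨ m}
      (⇒-residual₁ (∧-lowerˡ m x))
      (∨-upperʳ x m)
      (≤-trans (∧-distribˡ-∨-≤ (x ⇒ m) x m) (∨-least (modus-ponens x m) (∧-lowerʳ _ m)))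
    ... | inj₁ m≡x⇒m = no λ x≤m → completelyMeetIrreducible⇒𝟙≰
            (≤-trans (⇒-residual₁ (≤-trans (∧-lowerʳ 𝟙 x) x≤m)) (≡⇒≤ (sym m≡x⇒m)))
    ... | inj₂ m≡x∨m = yes (≤-trans (∨-upperˡ x m) (≡⇒≤ (sym m≡x∨m)))

  module _ {j : Carrier} (irr : CompletelyJoinIrreducible j) where

    joinIrreducible-binary : ∀ {x y} → x ≤ j → y ≤ j → j ≤ x ∨ y → j ≡ x ⊎ j ≡ y
    joinIrreducible-binary {x} {y} x≤j y≤j j≤x∨y with irr pair j≡⋁pair
      where
        pair : Bool → Carrier
        pair true  = x
        pair false = y
        j≡⋁pair : j ≡ ⋁ pair
        j≡⋁pair = ≤-antisym
          (≤-trans j≤x∨y (∨-least (⋁-upper pair true) (⋁-upper pair false)))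
          (⋁-least pair λ { true → x≤j ; false → y≤j })
    ... | true  , j≡x = inj₁ j≡x
    ... | false , j≡y = inj₂ j≡y

    completelyJoinIrreducible⇒prime : ∀ {x y} → j ≤ x ∨ y → j ≤ x ⊎ j ≤ y
    completelyJoinIrreducible⇒prime {x} {y} j≤x∨y
      with joinIrreducible-binary (∧-lowerˡ j x) (∧-lowerˡ j y)
             (≤-trans (∧-greatest ≤-refl j≤x∨y) (∧-distribˡ-∨-≤ j x y))
    ... | inj₁ j≡j∧x = inj₁ (≤-trans (≡⇒≤ j≡j∧x) (∧-lowerʳ j x))
    ... | inj₂ j≡j∧y = inj₂ (≤-trans (≡⇒≤ j≡j∧y) (∧-lowerʳ j y))

module PerfectHeytingAlgebraProperties (𝔸 : PerfectHeytingAlgebra) where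
  open PerfectHeytingAlgebra 𝔸
  open CompleteHeytingAlgebraProperties cha public

  ≤-fromJ∞ : ∀ {a b} → (∀ j → J∞ j → j ≤ a → j ≤ b) → a ≤ b
  ≤-fromJ∞ {a} {b} below = subst (_≤ b) (sym (join-dense a))
    (⋁-least proj₁ λ (j , Jj , j≤a) → below j Jj j≤a)

  ≤-fromM∞ : ∀ {a b} → (∀ m → M∞ m → b ≤ m → a ≤ m) → a ≤ b
  ≤-fromM∞ {a} {b} above = subst (a ≤_) (sym (meet-dense b))
    (⋀-greatest proj₁ λ (m , Mm , b≤m) → above m Mm b≤m)

  ≤-stable : ∀ {x y} → ¬ ¬ (x ≤ y) → x ≤ y
  ≤-stable {x} {y} ¬¬x≤y = ≤-fromM∞ λ m Mm y≤m →
    case-≤m y≤m (completelyMeetIrreducible-≤? (M∞-sound m Mm) x)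
    where
      case-≤m : ∀ {m} → y ≤ m → Dec (x ≤ m) → x ≤ m
      case-≤m _   (yes x≤m) = x≤m
      case-≤m y≤m (no x≰m)  = ⊥-elim (¬¬x≤y λ x≤y → x≰m (≤-trans x≤y y≤m))

  ≤-⋀∨⋀ : ∀ {I K} (f : I → Carrier) (g : K → Carrier) {a} →
          (∀ i k → a ≤ f i ∨ g k) → a ≤ ⋀ f ∨ ⋀ g
  ≤-⋀∨⋀ f g {a} a≤f∨g = ≤-fromJ∞ λ j Jj j≤a → ≤-stable λ j≰ →
    j≰ (≤-trans (j≤⋀g Jj j≤a j≰) (∨-upperʳ _ _))
    where
      -- If j ≰ g k for a single k, primality puts j below every f i.
      j≤⋀g : ∀ {j} → J∞ j → j ≤ a → ¬ (j ≤ ⋀ f ∨ ⋀ g) → j ≤ ⋀ g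
      j≤⋀g Jj j≤a j≰ = ⋀-greatest g λ k → ≤-stable λ j≰gk →
        j≰ (≤-trans (⋀-greatest f λ i →
              fromInj₁ (⊥-elim ∘ j≰gk)
                (completelyJoinIrreducible⇒prime (J∞-sound _ Jj) (≤-trans j≤a (a≤f∨g i k))))
            (∨-upperˡ _ _))

module Semantics (𝔸 : PerfectHeytingAlgebra) where
  open PerfectHeytingAlgebra 𝔸
  open PerfectHeytingAlgebraProperties 𝔸

  occurs? : ∀ p (φ : Formula 𝔸) → Dec (Occurs 𝔸 p φ)
  occurs? p (const _) = no λ ()
  occurs? p (var q)   = map′ (λ { refl → here }) (λ { here → refl }) (p ≟ q)
  occurs? p (φ ∨f ψ)  = map′ [ ∨ˡ , ∨ʳ ]′ (λ { (∨ˡ o) → inj₁ o ; (∨ʳ o) → inj₂ o })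
                             (occurs? p φ ⊎-dec occurs? p ψ)
  occurs? p (φ ∧f ψ)  = map′ [ ∧ˡ , ∧ʳ ]′ (λ { (∧ˡ o) → inj₁ o ; (∧ʳ o) → inj₂ o })
                             (occurs? p φ ⊎-dec occurs? p ψ)
  occurs? p (φ ⇒f ψ)  = map′ [ ⇒ˡ , ⇒ʳ ]′ (λ { (⇒ˡ o) → inj₁ o ; (⇒ʳ o) → inj₂ o })
                             (occurs? p φ ⊎-dec occurs? p ψ)
  occurs? p (□ φ)     = map′ in□ (λ { (in□ o) → o }) (occurs? p φ)
  occurs? p (◇ φ)     = map′ in◇ (λ { (in◇ o) → o }) (occurs? p φ)

  module _ (F : Frame 𝔸) where
    open Frame F

    Agree : Valuation 𝔸 W → Valuation 𝔸 W → Formula 𝔸 → Set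
    Agree V V′ φ = ∀ p → Occurs 𝔸 p φ → ∀ u → V p u ≡ V′ p u

    agree⇒eval-≤ : ∀ {V V′} φ → Agree V V′ φ → ∀ u → eval 𝔸 F V φ u ≤ eval 𝔸 F V′ φ u
    agree⇒eval-≤ (const _) agree u = ≤-refl
    agree⇒eval-≤ (var p)   agree u = ≡⇒≤ (agree p here u)
    agree⇒eval-≤ (φ ∨f ψ)  agree u =
      ∨-mono-≤ (agree⇒eval-≤ φ (λ p → agree p ∘ ∨ˡ) u) (agree⇒eval-≤ ψ (λ p → agree p ∘ ∨ʳ) u)
    agree⇒eval-≤ (φ ∧f ψ)  agree u =
      ∧-mono-≤ (agree⇒eval-≤ φ (λ p → agree p ∘ ∧ˡ) u) (agree⇒eval-≤ ψ (λ p → agree p ∘ ∧ʳ) u)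
    agree⇒eval-≤ (φ ⇒f ψ)  agree u =
      ⇒-mono-≤ (agree⇒eval-≤ φ (λ p o v → sym (agree p (⇒ˡ o) v)) u)
               (agree⇒eval-≤ ψ (λ p → agree p ∘ ⇒ʳ) u)
    agree⇒eval-≤ (□ φ)     agree u =
      ⋀-mono-≤ _ _ λ v → ⇒-mono-≤ ≤-refl (agree⇒eval-≤ φ (λ p → agree p ∘ in□) v)
    agree⇒eval-≤ (◇ φ)     agree u =
      ⋁-mono-≤ _ _ λ v → ∧-mono-≤ ≤-refl (agree⇒eval-≤ φ (λ p → agree p ∘ in◇) v)

    splice : Formula 𝔸 → Valuation 𝔸 W → Valuation 𝔸 W → Valuation 𝔸 W
    splice φ V₁ V₂ p with occurs? p φ
    ... | yes _ = V₁ p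
    ... | no _  = V₂ p

    splice-agreeˡ : ∀ φ V₁ V₂ → Agree (splice φ V₁ V₂) V₁ φ
    splice-agreeˡ φ V₁ V₂ p o u with occurs? p φ
    ... | yes _   = refl
    ... | no ¬o   = ⊥-elim (¬o o)

    splice-agreeʳ : ∀ {φ ψ} → NoSharedVars 𝔸 φ ψ → ∀ V₁ V₂ → Agree (splice φ V₁ V₂) V₂ ψ
    splice-agreeʳ {φ} disjoint V₁ V₂ p o u with occurs? p φ
    ... | yes o′ = ⊥-elim (disjoint p o′ o)
    ... | no _   = refl

    forcingDegree : W → Formula 𝔸 → Carrier
    forcingDegree w φ = ⋀ λ V → eval 𝔸 F V φ w

    forces-forcingDegree : ∀ w φ → Forces 𝔸 F w (forcingDegree w φ) φ
    forces-forcingDegree w φ = ⋀-lower (λ V → eval 𝔸 F V φ w)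

    forces-∨-split : ∀ {w a} φ ψ → NoSharedVars 𝔸 φ ψ → Forces 𝔸 F w a (φ ∨f ψ) →
                     ∀ V₁ V₂ → a ≤ eval 𝔸 F V₁ φ w ∨ eval 𝔸 F V₂ ψ w
    forces-∨-split {w} φ ψ disjoint ⊩φ∨ψ V₁ V₂ = ≤-trans (⊩φ∨ψ (splice φ V₁ V₂))
      (∨-mono-≤ (agree⇒eval-≤ φ (splice-agreeˡ φ V₁ V₂) w)
                (agree⇒eval-≤ ψ (splice-agreeʳ disjoint V₁ V₂) w))

    forces-∨-intro : ∀ {w a a₁ a₂} φ ψ → Forces 𝔸 F w a₁ φ → Forces 𝔸 F w a₂ ψ →
                     a ≤ a₁ ∨ a₂ → Forces 𝔸 F w a (φ ∨f ψ)
    forces-∨-intro φ ψ ⊩φ ⊩ψ a≤a₁∨a₂ V = ≤-trans a≤a₁∨a₂ (∨-mono-≤ (⊩φ V) (⊩ψ V))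

lemma7p6 : (𝔸 : PerfectHeytingAlgebra) (F : Frame 𝔸) (w : Frame.W F)
    (a : PerfectHeytingAlgebra.Carrier 𝔸) (φ ψ : Formula 𝔸) →
    NoSharedVars 𝔸 φ ψ →
    (Forces 𝔸 F w a (φ ∨f ψ) →
      ∃[ a₁ ] ∃[ a₂ ] (Forces 𝔸 F w a₁ φ × Forces 𝔸 F w a₂ ψ ×
        PerfectHeytingAlgebra._≤_ 𝔸 a (PerfectHeytingAlgebra._∨_ 𝔸 a₁ a₂)))
    × ((∃[ a₁ ] ∃[ a₂ ] (Forces 𝔸 F w a₁ φ × Forces 𝔸 F w a₂ ψ ×
        PerfectHeytingAlgebra._≤_ 𝔸 a (PerfectHeytingAlgebra._∨_ 𝔸 a₁ a₂)))
      → Forces 𝔸 F w a (φ ∨f ψ))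
lemma7p6 𝔸 F w a φ ψ disjoint =
    (λ ⊩φ∨ψ → forcingDegree F w φ , forcingDegree F w ψ
            , forces-forcingDegree F w φ , forces-forcingDegree F w ψ
            , ≤-⋀∨⋀ _ _ (forces-∨-split F φ ψ disjoint ⊩φ∨ψ))
  , (λ (a₁ , a₂ , ⊩φ , ⊩ψ , a≤a₁∨a₂) → forces-∨-intro F φ ψ ⊩φ ⊩ψ a≤a₁∨a₂)
  where
    open PerfectHeytingAlgebraProperties 𝔸
    open Semantics 𝔸
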